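{- Let $F=(k_F)_{k\geq 0}$ be a sequence of positive integers and let $n\in\mathbb{N}\cup\{\infty\}$. Let $\Pi$ be the cobweb poset with levels $\Phi_0,\Phi_1,\dots$ (indices $k\le n$), where $|\Phi_k|=k_F$. Let $\mu$ denote the Möbius function of $\Pi$ (the inverse of the zeta function $\zeta(x,y)=[x\le y]$ in the incidence algebra of $\Pi$). Then for $x\in\Phi_r$ and $y\in\Phi_s$ with $s>r$, $$\mu(x,y)=(-1)^{s-r}\prod_{k=r+1}^{s-1}\bigl(k_F-1\bigr),$$ where the empty product (case $s=r+1$) equals $1$. In addition $\mu(x,x)=1$ for every $x\in\Pi$.
   Context: A cobweb poset with levels $\Phi_0,\Phi_1,\dots$ is the ordinal (linear) sum $\Pi=\Phi_0\oplus\Phi_1\oplus\cdots$ of pairwise disjoint finite nonempty antichains $\Phi_k$: its underlying set is $\bigcup_k\Phi_k$, and for $x\in\Phi_r$, $y\in\Phi_s$ one has $x<y$ if and only if $r<s$ (elements of the same level are incomparable). The notation $k_F$ denotes the $k$-th term $F_k$ of the sequence $F$. The Möbius function is defined by $\mu(x,x)=1$, $\mu(x,y)=-\sum_{x\le z<y}\mu(x,z)$ for $x<y$, and $\mu(x,y)=0$ if $x\not\le y$. -}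

module Defs where

open import Data.Nat as ℕ using (ℕ; zero; suc; _≤_; _<_)
import Data.Nat.Properties as ℕP
open import Data.Fin using (Fin; toℕ)
open import Data.Integer as ℤ using (ℤ; +_; -_; _^_)
open import Data.Integer using () renaming (_*_ to _*ℤ_; _-_ to _-ℤ_)
open import Data.List using (List; []; _∷_; map; filter; _++_; upTo)
open import Data.List using () renaming (sum to sumℤ')
import Data.List as L
open import Data.Fin using () renaming (_≟_ to _≟F_)
open import Data.Maybe using (Maybe; just; nothing)
open import Data.Unit using (⊤; tt)
open import Data.Product using (_×_; _,_)
open import Data.Sum using (_⊎_; inj₁; inj₂)
open import Relation.Nullary using (¬_; Dec; yes; no)
open import Relation.Nullary.Decidable using (_×-dec_; _⊎-dec_; ¬?)
open import Relation.Binary.PropositionalEquality using (_≡_)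
open import Data.Vec.Functional using () 

-- ℕ ∪ {∞}: nothing = ∞, just n = n.
ℕ∞ : Set
ℕ∞ = Maybe ℕ

InRange : ℕ∞ → ℕ → Set
InRange nothing  k = ⊤
InRange (just n) k = k ≤ n

InRange-pred : (n : ℕ∞) {k : ℕ} → InRange n (suc k) → InRange n k
InRange-pred nothing  _ = tt
InRange-pred (just n) p = ℕP.≤-trans (ℕP.n≤1+n _) p

-- Elements of the cobweb poset Π = Φ_0 ⊕ Φ_1 ⊕ ... (levels k ≤ n),
-- with Φ_k = Fin (F k) (so |Φ_k| = k_F); an element is (level, index).
record Elem (F : ℕ → ℕ) (n : ℕ∞) : Set where
  constructor elem
  field
    lev : ℕ
    idx : Fin (F lev)
    ok  : InRange n lev
open Elem public

module Cobweb (F : ℕ → ℕ) (n : ℕ∞) where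

  _≈_ : Elem F n → Elem F n → Set
  x ≈ y = (lev x ≡ lev y) × (toℕ (idx x) ≡ toℕ (idx y))

  _≈?_ : (x y : Elem F n) → Dec (x ≈ y)
  x ≈? y = (lev x ℕ.≟ lev y) ×-dec (toℕ (idx x) ℕ.≟ toℕ (idx y))

  _≼_ : Elem F n → Elem F n → Set
  x ≼ y = (x ≈ y) ⊎ (lev x < lev y)

  _≼?_ : (x y : Elem F n) → Dec (x ≼ y)
  x ≼? y = (x ≈? y) ⊎-dec (lev x ℕ.<? lev y)

  _≺_ : Elem F n → Elem F n → Set
  x ≺ y = (x ≼ y) × ¬ (x ≈ y)

  _≺?_ : (x y : Elem F n) → Dec (x ≺ y)
  x ≺? y = (x ≼? y) ×-dec ¬? (x ≈? y)

  levelElems : (k : ℕ) → InRange n k → List (Elem F n)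
  levelElems k p = map (λ i → elem k i p) (L.allFin (F k))

  -- all elements of levels 0..m (a finite set containing every z ≤ y when lev y = m)
  elemsUpTo : (m : ℕ) → InRange n m → List (Elem F n)
  elemsUpTo zero    p = levelElems zero p
  elemsUpTo (suc m) p = elemsUpTo m (InRange-pred n p) ++ levelElems (suc m) p

  sumℤ : List ℤ → ℤ
  sumℤ = L.foldr ℤ._+_ (+ 0)

  μF : ℕ → Elem F n → Elem F n → ℤ
  μF zero    x y = + 0
  μF (suc f) x y with x ≈? y
  ... | yes _ = + 1
  ... | no  _ with x ≺? y
  ...   | yes _ = - sumℤ (map (μF f x)
                    (filter (λ z → (x ≼? z) ×-dec (z ≺? y)) (elemsUpTo (lev y) (ok y))))
  ...   | no  _ = + 0

  -- fuel lev y + 1 suffices: every z < y has lev z < lev y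
  μ : Elem F n → Elem F n → ℤ
  μ x y = μF (suc (lev y)) x y

-- ∏_{k=a}^{b} g k  (empty product = 1 if b < a)
prodFromTo : (ℕ → ℤ) → ℕ → ℕ → ℤ
prodFromTo g a b = L.foldr _*ℤ_ (+ 1) (map (λ i → g (a ℕ.+ i)) (upTo (suc b ℕ.∸ a)))

-- Write C(r,s) for the claimed value of μ(x,y).  It satisfies C(r,r+1) = -1 and
-- C(r,k+1) = -(k_F - 1) C(r,k) for k > r.  In the defining sum of μ(x,y) over
-- x ≤ z < y, the element x contributes 1 and each of the k_F elements of a level
-- r < k < s contributes C(r,k) by induction, so the partial sum up to level m is
-- the telescoping sum 1 + Σ_{r<k≤m} k_F C(r,k) = -C(r,m+1); at m = s-1 this is -C(r,s).
module Submission where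

open import Defs
open import Data.Nat using (ℕ; _<_; _∸_; _+_)
open import Data.Integer using (ℤ; +_; -_; _^_; _*_; _-_)
open import Data.Product using (_×_)
open import Relation.Binary.PropositionalEquality using (_≡_)

open import Data.Nat using (zero; suc; _≤_; _≤?_; z≤n; s≤s)
import Data.Nat.Properties as NP
open import Data.Integer using () renaming (_+_ to _+ℤ_)
import Data.Integer.Properties as ZP
open import Data.Integer.Solver using (module +-*-Solver)
open import Data.Fin using (Fin; toℕ)
open import Data.Fin.Properties using (toℕ<n)
open import Data.List using (List; []; _∷_; map; filter; _++_; foldr; tabulate; allFin; applyUpTo; upTo)
open import Data.List.Properties using (map-++; filter-++; map-tabulate; map-applyUpTo)
open import Data.Product using (_,_; proj₂)
open import Data.Sum using (inj₁; inj₂)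
open import Data.Empty using (⊥-elim)
open import Function using (id)
open import Relation.Nullary using (¬_; yes; no)
open import Relation.Nullary.Decidable using (_×-dec_)
open import Relation.Unary using (Pred; Decidable)
open import Relation.Binary.PropositionalEquality using (refl; sym; trans; cong; cong₂; subst; module ≡-Reasoning)

sumℤ : List ℤ → ℤ
sumℤ = foldr _+ℤ_ (+ 0)

productℤ : List ℤ → ℤ
productℤ = foldr _*_ (+ 1)

sumℤ-++ : ∀ xs ys → sumℤ (xs ++ ys) ≡ sumℤ xs +ℤ sumℤ ys
sumℤ-++ []       ys = sym (ZP.+-identityˡ _)
sumℤ-++ (x ∷ xs) ys = trans (cong (x +ℤ_) (sumℤ-++ xs ys)) (sym (ZP.+-assoc x _ _))

sumℤ-filter-map : ∀ {a b ℓ} {A : Set a} {B : Set b} {P : Pred A ℓ} (P? : Decidable P)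
  (g : A → ℤ) (e : B → A) (v : B → ℤ) →
  (∀ i → P (e i) → g (e i) ≡ v i) → (∀ i → ¬ P (e i) → v i ≡ + 0) →
  ∀ is → sumℤ (map g (filter P? (map e is))) ≡ sumℤ (map v is)
sumℤ-filter-map P? g e v agree vanish []       = refl
sumℤ-filter-map P? g e v agree vanish (i ∷ is) with P? (e i)
... | yes p = cong₂ _+ℤ_ (agree i p) (sumℤ-filter-map P? g e v agree vanish is)
... | no ¬p = trans (sumℤ-filter-map P? g e v agree vanish is)
  (trans (sym (ZP.+-identityˡ _)) (cong (_+ℤ sumℤ (map v is)) (sym (vanish i ¬p))))

sumℤ-tabulate-const : ∀ N c → sumℤ (tabulate {n = N} (λ _ → c)) ≡ + N * c
sumℤ-tabulate-const zero    c = sym (ZP.*-zeroˡ c)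
sumℤ-tabulate-const (suc N) c = trans (cong (c +ℤ_) (sumℤ-tabulate-const N c))
  (sym (trans (ZP.*-distribʳ-+ c (+ 1) (+ N)) (cong (_+ℤ + N * c) (ZP.*-identityˡ c))))

sumℤ-tabulate-zero : ∀ N → sumℤ (tabulate {n = N} (λ _ → + 0)) ≡ + 0
sumℤ-tabulate-zero N = trans (sumℤ-tabulate-const N (+ 0)) (ZP.*-zeroʳ (+ N))

δ : ℕ → ℕ → ℤ
δ zero    zero    = + 1
δ zero    (suc b) = + 0
δ (suc a) zero    = + 0
δ (suc a) (suc b) = δ a b

δ-≡ : ∀ {a b} → a ≡ b → δ a b ≡ + 1
δ-≡ {zero}  refl = refl
δ-≡ {suc a} refl = δ-≡ {a} refl

δ-≢ : ∀ {a b} → ¬ a ≡ b → δ a b ≡ + 0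
δ-≢ {zero}  {zero}  a≢b = ⊥-elim (a≢b refl)
δ-≢ {zero}  {suc b} a≢b = refl
δ-≢ {suc a} {zero}  a≢b = refl
δ-≢ {suc a} {suc b} a≢b = δ-≢ (λ a≡b → a≢b (cong suc a≡b))

sumℤ-tabulate-δ : ∀ {N t} → t < N → sumℤ (tabulate {n = N} (λ i → δ (toℕ i) t)) ≡ + 1
sumℤ-tabulate-δ {suc N} {zero}  _         = cong (+ 1 +ℤ_) (sumℤ-tabulate-zero N)
sumℤ-tabulate-δ {suc N} {suc t} (s≤s t<N) = trans (ZP.+-identityˡ _) (sumℤ-tabulate-δ t<N)

productℤ-applyUpTo-suc : ∀ (h : ℕ → ℤ) m →
  productℤ (applyUpTo h (suc m)) ≡ productℤ (applyUpTo h m) * h m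
productℤ-applyUpTo-suc h zero    = trans (ZP.*-identityʳ (h 0)) (sym (ZP.*-identityˡ (h 0)))
productℤ-applyUpTo-suc h (suc m) =
  trans (cong (h 0 *_) (productℤ-applyUpTo-suc (λ i → h (suc i)) m)) (sym (ZP.*-assoc (h 0) _ _))

prodFromTo-empty : ∀ g {a b} → b < a → prodFromTo g a b ≡ + 1
prodFromTo-empty g b<a rewrite NP.m≤n⇒m∸n≡0 b<a = refl

prodFromTo-snoc : ∀ g {a b} → a ≤ suc b → prodFromTo g a (suc b) ≡ prodFromTo g a b * g (suc b)
prodFromTo-snoc g {a} {b} a≤1+b = begin
  productℤ (map h (upTo (suc (suc b) ∸ a)))  ≡⟨ cong (λ l → productℤ (map h (upTo l))) (NP.+-∸-assoc 1 a≤1+b) ⟩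
  productℤ (map h (upTo (suc m)))            ≡⟨ cong productℤ (map-applyUpTo id h (suc m)) ⟩
  productℤ (applyUpTo h (suc m))             ≡⟨ productℤ-applyUpTo-suc h m ⟩
  productℤ (applyUpTo h m) * h m             ≡⟨ cong₂ _*_ (cong productℤ (sym (map-applyUpTo id h m)))
                                                          (cong g (NP.m+[n∸m]≡n a≤1+b)) ⟩
  prodFromTo g a b * g (suc b)               ∎
  where
  open ≡-Reasoning
  h : ℕ → ℤ
  h i = g (a + i)
  m : ℕ
  m = suc b ∸ a

closedForm : (ℕ → ℤ) → ℕ → ℕ → ℤ
closedForm g r s = ((- (+ 1)) ^ (s ∸ r)) * prodFromTo g (r + 1) (s ∸ 1)

closedForm-base : ∀ g r → closedForm g r (suc r) ≡ - (+ 1)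
closedForm-base g r =
  cong₂ (λ e p → ((- (+ 1)) ^ e) * p) (NP.m+n∸n≡m 1 r) (prodFromTo-empty g (NP.m<m+n r (s≤s z≤n)))

open +-*-Solver using (solve; _:=_; _:*_; _:+_; _:-_; :-_; con)

closedForm-step : ∀ g {r k} → r < k → closedForm g r (suc k) ≡ - g k * closedForm g r k
closedForm-step g {r} {suc k} r<1+k = begin
  ((- (+ 1)) ^ (suc (suc k) ∸ r)) * prodFromTo g (r + 1) (suc k)
    ≡⟨ cong₂ (λ e p → ((- (+ 1)) ^ e) * p) (NP.+-∸-assoc 1 (NP.<⇒≤ r<1+k))
             (prodFromTo-snoc g (subst (_≤ suc k) (NP.+-comm 1 r) r<1+k)) ⟩
  (- (+ 1) * sign) * (prodFromTo g (r + 1) k * g (suc k))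
    ≡⟨ regroup sign (prodFromTo g (r + 1) k) (g (suc k)) ⟩
  - g (suc k) * (sign * prodFromTo g (r + 1) k) ∎
  where
  open ≡-Reasoning
  sign : ℤ
  sign = (- (+ 1)) ^ (suc k ∸ r)
  regroup : ∀ a b c → (- (+ 1) * a) * (b * c) ≡ - c * (a * b)
  regroup = solve 3 (λ a b c → (con (- (+ 1)) :* a) :* (b :* c) := (:- c) :* (a :* b)) refl

-- With c = C(r,k) and f = k_F, the right side is -C(r,k+1) by closedForm-step.
partialSum-step : ∀ c f → - c +ℤ f * c ≡ - (- (f - + 1) * c)
partialSum-step = solve 2 (λ c f → (:- c) :+ f :* c := :- ((:- (f :- con (+ 1))) :* c)) refl

module _ (F : ℕ → ℕ) (n : ℕ∞) where
  open Cobweb F n hiding (sumℤ)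

  predF : ℕ → ℤ
  predF k = + F k - + 1

  closed : ℕ → ℕ → ℤ
  closed = closedForm predF

  μF-refl : ∀ {f x y} → 0 < f → x ≈ y → μF f x y ≡ + 1
  μF-refl {suc f} {x} {y} _ x≈y with x ≈? y
  ... | yes _   = refl
  ... | no x≉y = ⊥-elim (x≉y x≈y)

  module IntervalSum (x y : Elem F n) (r<s : lev x < lev y) (μx : Elem F n → ℤ)
    (μx-refl : ∀ z → x ≈ z → μx z ≡ + 1)
    (μx-between : ∀ z → lev x < lev z → lev z < lev y → μx z ≡ closed (lev x) (lev z)) where

    r s : ℕ
    r = lev x
    s = lev y

    InInterval : Elem F n → Set
    InInterval z = (x ≼ z) × (z ≺ y)

    inInterval-levels : ∀ {z} → InInterval z → r ≤ lev z × lev z < s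
    inInterval-levels (_ , inj₁ z≈y , z≉y)            = ⊥-elim (z≉y z≈y)
    inInterval-levels (inj₁ (r≡k , _) , inj₂ k<s , _) = NP.≤-reflexive r≡k , k<s
    inInterval-levels (inj₂ r<k , inj₂ k<s , _)       = NP.<⇒≤ r<k , k<s

    inInterval? : Decidable InInterval
    inInterval? z = (x ≼? z) ×-dec (z ≺? y)

    sumOver : List (Elem F n) → ℤ
    sumOver zs = sumℤ (map μx (filter inInterval? zs))

    sumOver-++ : ∀ zs ws → sumOver (zs ++ ws) ≡ sumOver zs +ℤ sumOver ws
    sumOver-++ zs ws = trans (cong (λ l → sumℤ (map μx l)) (filter-++ inInterval? zs ws))
      (trans (cong sumℤ (map-++ μx (filter inInterval? zs) (filter inInterval? ws)))
             (sumℤ-++ (map μx (filter inInterval? zs)) (map μx (filter inInterval? ws))))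

    levelSum : ∀ k p → (v : Fin (F k) → ℤ) →
      (∀ i → InInterval (elem k i p) → μx (elem k i p) ≡ v i) →
      (∀ i → ¬ InInterval (elem k i p) → v i ≡ + 0) →
      sumOver (levelElems k p) ≡ sumℤ (tabulate v)
    levelSum k p v agree vanish =
      trans (sumℤ-filter-map inInterval? μx (λ i → elem k i p) v agree vanish (allFin (F k)))
            (cong sumℤ (map-tabulate id v))

    levelSum-outside : ∀ k p → ¬ (r ≤ k × k < s) → sumOver (levelElems k p) ≡ + 0
    levelSum-outside k p outside =
      trans (levelSum k p (λ _ → + 0)
                      (λ i z∈ → ⊥-elim (outside (inInterval-levels {elem k i p} z∈))) (λ _ _ → refl))
            (sumℤ-tabulate-zero (F k))

    levelSum-bottom : ∀ k p → r ≡ k → sumOver (levelElems k p) ≡ + 1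
    levelSum-bottom k p refl =
      trans (levelSum k p (λ i → δ (toℕ i) (toℕ (idx x))) agree vanish) (sumℤ-tabulate-δ (toℕ<n (idx x)))
      where
      agree : ∀ i → InInterval (elem r i p) → μx (elem r i p) ≡ δ (toℕ i) (toℕ (idx x))
      agree i (inj₁ x≈z , _) = trans (μx-refl _ x≈z) (sym (δ-≡ (sym (proj₂ x≈z))))
      agree i (inj₂ r<r , _) = ⊥-elim (NP.<-irrefl refl r<r)
      vanish : ∀ i → ¬ InInterval (elem r i p) → δ (toℕ i) (toℕ (idx x)) ≡ + 0
      vanish i z∉ = δ-≢ λ i≡x → z∉ (inj₁ (refl , sym i≡x) , inj₂ r<s , λ (r≡s , _) → NP.<-irrefl r≡s r<s)

    levelSum-between : ∀ k p → r < k → k < s → sumOver (levelElems k p) ≡ + F k * closed r k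
    levelSum-between k p r<k k<s =
      trans (levelSum k p (λ _ → closed r k) (λ i _ → μx-between _ r<k k<s) vanish)
            (sumℤ-tabulate-const (F k) (closed r k))
      where
      vanish : ∀ i → ¬ InInterval (elem k i p) → closed r k ≡ + 0
      vanish i z∉ = ⊥-elim (z∉ (inj₂ r<k , inj₂ k<s , λ (k≡s , _) → NP.<-irrefl k≡s k<s))

    partialSum-below : ∀ k p → k < r → sumOver (elemsUpTo k p) ≡ + 0
    partialSum-below zero    p k<r = levelSum-outside zero p λ (r≤k , _) → NP.<-irrefl refl (NP.<-≤-trans k<r r≤k)
    partialSum-below (suc k) p k<r = trans (sumOver-++ (elemsUpTo k _) (levelElems (suc k) p))
      (cong₂ _+ℤ_ (partialSum-below k _ (NP.<-trans (NP.n<1+n k) k<r))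
                  (levelSum-outside (suc k) p λ (r≤k , _) → NP.<-irrefl refl (NP.<-≤-trans k<r r≤k)))

    partialSum-between : ∀ k p → r ≤ k → k < s → sumOver (elemsUpTo k p) ≡ - closed r (suc k)
    partialSum-between zero p z≤n _ = trans (levelSum-bottom zero p refl) (cong -_ (sym (closedForm-base predF 0)))
    partialSum-between (suc k) p r≤1+k 1+k<s with r ≤? k
    ... | yes r≤k = begin
      sumOver (elemsUpTo (suc k) p)
        ≡⟨ sumOver-++ (elemsUpTo k _) (levelElems (suc k) p) ⟩
      sumOver (elemsUpTo k _) +ℤ sumOver (levelElems (suc k) p)
        ≡⟨ cong₂ _+ℤ_ (partialSum-between k _ r≤k (NP.<-trans (NP.n<1+n k) 1+k<s))
                      (levelSum-between (suc k) p (s≤s r≤k) 1+k<s) ⟩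
      - closed r (suc k) +ℤ + F (suc k) * closed r (suc k)
        ≡⟨ partialSum-step (closed r (suc k)) (+ F (suc k)) ⟩
      - (- (+ F (suc k) - + 1) * closed r (suc k))
        ≡⟨ cong -_ (sym (closedForm-step predF (s≤s r≤k))) ⟩
      - closed r (suc (suc k)) ∎
      where open ≡-Reasoning
    ... | no r≰k = begin
      sumOver (elemsUpTo (suc k) p)
        ≡⟨ sumOver-++ (elemsUpTo k _) (levelElems (suc k) p) ⟩
      sumOver (elemsUpTo k _) +ℤ sumOver (levelElems (suc k) p)
        ≡⟨ cong₂ _+ℤ_ (partialSum-below k _ (NP.≰⇒> r≰k)) (levelSum-bottom (suc k) p r≡1+k) ⟩
      + 1
        ≡⟨ cong -_ (sym (closedForm-base predF (suc k))) ⟩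
      - closed (suc k) (suc (suc k))
        ≡⟨ cong (λ t → - closed t (suc (suc k))) (sym r≡1+k) ⟩
      - closed r (suc (suc k)) ∎
      where
      open ≡-Reasoning
      r≡1+k : r ≡ suc k
      r≡1+k = NP.≤-antisym r≤1+k (NP.≰⇒> r≰k)

    partialSum-top : ∀ k p → k ≡ s → sumOver (elemsUpTo k p) ≡ - closed r k
    partialSum-top zero    p refl = ⊥-elim (NP.n≮0 r<s)
    partialSum-top (suc k) p refl = trans (sumOver-++ (elemsUpTo k _) (levelElems (suc k) p))
      (trans (cong₂ _+ℤ_ (partialSum-between k _ (NP.≤-pred r<s) (NP.n<1+n k))
                         (levelSum-outside (suc k) p λ (_ , s<s) → NP.<-irrefl refl s<s))
             (ZP.+-identityʳ _))

  μF-between : ∀ f x y → lev x < lev y → lev y < f → μF f x y ≡ closed (lev x) (lev y)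
  μF-between (suc f) x y r<s s<1+f with x ≈? y
  ... | yes (r≡s , _) = ⊥-elim (NP.<-irrefl r≡s r<s)
  ... | no x≉y with x ≺? y
  ...   | no x⊀y = ⊥-elim (x⊀y (inj₂ r<s , x≉y))
  ...   | yes _ = trans (cong -_ (IntervalSum.partialSum-top x y r<s (μF f x) μx-refl μx-between (lev y) (ok y) refl))
                        (ZP.neg-involutive _)
    where
    s≤f : lev y ≤ f
    s≤f = NP.≤-pred s<1+f
    μx-refl : ∀ z → x ≈ z → μF f x z ≡ + 1
    μx-refl z = μF-refl (NP.<-≤-trans (NP.≤-<-trans z≤n r<s) s≤f)
    μx-between : ∀ z → lev x < lev z → lev z < lev y → μF f x z ≡ closed (lev x) (lev z)
    μx-between z r<k k<s = μF-between f x z r<k (NP.<-≤-trans k<s s≤f)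

mainTheorem1 : (F : ℕ → ℕ) → (∀ k → 0 < F k) → (n : ℕ∞) →
    ((x y : Elem F n) → lev x < lev y →
      Cobweb.μ F n x y ≡ ((- (+ 1)) ^ (lev y ∸ lev x)) * prodFromTo (λ k → + F k - + 1) (lev x + 1) (lev y ∸ 1))
    × ((x : Elem F n) → Cobweb.μ F n x x ≡ + 1)
mainTheorem1 F _ n =
  (λ x y r<s → μF-between F n (suc (lev y)) x y r<s (NP.n<1+n (lev y))) ,
  (λ x → μF-refl F n {y = x} (s≤s z≤n) (refl , refl))
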